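{- Let $X$ be an access sequence with one access per time step, $T$ an initial tree, and $G(X)=G_T(X)$. Suppose there are keys $a<b$ and times $t_1<t_2$ with $(b,t_2)\in G(X)\setminus X$ and $(a,t_1)\in G(X)$. Then $X$ contains a point in $[b,\infty)\times[t_1+1,t_2]$ or in $[a+1,\infty)\times\{t_2\}$. Symmetrically, if $(a,t_2)\in G(X)\setminus X$ and $(b,t_1)\in G(X)$, then $X$ contains a point in $(-\infty,a]\times[t_1+1,t_2]$ or in $(-\infty,b-1]\times\{t_2\}$.
   Context: The access sequence $X=(x_1,\dots,x_m)$ is identified with the point set $\{(x_t,t)\}$ (key = column, time = row). Geometric Greedy: the initial BST $T$ on $[n]$ is encoded by a fixed point set in rows $-(n-1),\dots,0$ (standard geometric encoding; each column contains a point). For $t=1,\dots,m$: with $p=(x_t,t)$ and, for each key $a$, $q=(a,\tau(a,t))$ where $\tau(a,t)$ is the last row $<t$ with a point in column $a$, add $(a,t)$ iff the closed rectangle with corners $p,q$ contains no point other than $p,q$. $G_T(X)$ is the set of points added in rows $1,\dots,m$; it contains $X$. -}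

module Defs where

open import Data.Nat using (ℕ; zero; suc; _<_; _≤_; _⊓_; _⊔_; _<ᵇ_; _≡ᵇ_)
open import Data.Bool using (if_then_else_)
open import Data.Integer as ℤ using (ℤ; +_; -_)
open import Data.Fin using (Fin; toℕ)
open import Data.Vec using (Vec; []; _∷_; lookup)
open import Data.Product using (Σ; _×_; _,_)
open import Data.Sum using (_⊎_)
open import Relation.Binary.PropositionalEquality using (_≡_)

-- Binary search trees whose in-order key set is exactly [lo, hi) ⊆ ℕ.
data BST : ℕ → ℕ → Set where
  leaf : ∀ {lo} → BST lo lo
  node : ∀ {lo hi} (k : ℕ) → BST lo k → BST (suc k) hi → BST lo hi

-- depth of key a in the tree (root has depth 0); only meaningful for keys of the tree
depth : ∀ {lo hi} → BST lo hi → ℕ → ℕ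
depth leaf a = 0
depth (node k l r) a =
  if a <ᵇ k then suc (depth l a)
  else if a ≡ᵇ k then 0
  else suc (depth r a)

-- x_{i+1}, the key accessed at time i+1 (0 for out-of-range indices; never used there)
accessAt : ∀ {n m} → Vec (Fin n) m → ℕ → ℕ
accessAt [] i = 0
accessAt (x ∷ xs) zero = toℕ x
accessAt (x ∷ xs) (suc i) = accessAt xs i

Point : Set
Point = ℕ × ℤ

module Greedy {n m : ℕ} (T : BST 0 n) (X : Vec (Fin n) m) where

  -- Pts k c r : (c , r) is a point of the picture after Greedy has processed rows 1..k,
  -- i.e. an initial-tree point (rows -(n-1)..0) or a Greedy point in rows 1..k.
  Pts : ℕ → Point → Set
  -- Added k a : Greedy adds (a , k+1) when processing the access p = (x_{k+1}, k+1).
  Added : ℕ → ℕ → Set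

  Pts zero (c , r) = c < n × r ≡ - (+ depth T c)
  Pts (suc k) (c , r) = (r ℤ.≤ + k × Pts k (c , r)) ⊎ (r ≡ + suc k × Added k c)

  Added k a =
    a < n ×
    Σ ℤ λ τ →
      -- τ = τ(a, k+1): the last row < k+1 with a point in column a
      (Pts k (a , τ) × (∀ r → Pts k (a , r) → r ℤ.≤ τ)) ×
      -- the closed rectangle with corners p = (x, k+1) and q = (a, τ) contains no point
      -- (of the current picture, i.e. earlier points together with p) other than p and q
      (∀ c r → (accessAt X k ⊓ a) ≤ c → c ≤ (accessAt X k ⊔ a) → τ ℤ.≤ r → r ℤ.≤ + suc k →
        (Pts k (c , r) ⊎ (c , r) ≡ (accessAt X k , + suc k)) →
        (c , r) ≡ (accessAt X k , + suc k) ⊎ (c , r) ≡ (a , τ))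

  InG : ℕ → ℕ → Set
  InG c t = 1 ≤ t × t ≤ m × Pts m (c , + t)

  -- (c , t) ∈ X  (times are 1-based: x_t = lookup X (t-1))
  InX : ℕ → ℕ → Set
  InX c t = Σ (Fin m) λ i → t ≡ suc (toℕ i) × toℕ (lookup X i) ≡ c

-- Follow the Greedy points of column b downwards from row t₂.  At each such point (b, s+1)
-- look at the access x_{s+1}.  If it lies at or beyond b, or strictly between a and b in
-- row t₂, it is the required access.  If it lies at or before a, then (a, t₁) sits in the
-- rectangle Greedy inspected, which was empty, so the previous point of column b is still
-- above row t₁ and we descend to it.  If it lies strictly between a and b below row t₂, the
-- access point (x_{s+1}, s+1) takes the role of (a, t₁) closer to t₂; since that region is
-- contained in the one for (a, t₁), we restart from there.  The mirror statement is the
-- same argument with the key order reversed.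
module Submission where

open import Defs
open import Data.Nat using (ℕ; zero; suc; _<_; _≤_; _⊓_; _⊔_; _∸_; z≤n; s≤s; s≤s⁻¹; _≤′_; ≤′-step; _≤?_; _≟_)
open import Data.Nat.Base using (≤′-refl)
open import Data.Nat.Properties
  using (≤-refl; ≤-trans; <⇒≤; <-irrefl; <-trans; <⇒≱; ≰⇒>; ≮⇒≥; ≤∧≢⇒<; <⇒≢; n≤1+n;
         ≤⇒≤′; ≤′⇒≤; ≤-antisym; ⊓-idem; ⊔-idem; ∸-monoʳ-<; m⊓n≤m; m⊓n≤n; m≤m⊔n; m≤n⊔m)
open import Data.Nat.Induction using (<-wellFounded)
open import Data.Integer as ℤ using (ℤ; +_; -[1+_]; +≤+; -≤+)
open import Data.Integer.Properties using (≤-reflexive; +-injective)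
import Data.Integer.Properties as ℤ
open import Data.Fin using (Fin; toℕ; fromℕ<)
open import Data.Fin.Properties using (any?; toℕ<n; toℕ-fromℕ<)
open import Data.Vec using (Vec; _∷_; lookup)
open import Data.Product using (Σ; _×_; _,_; proj₁; proj₂)
open import Data.Sum using (_⊎_; inj₁; inj₂)
open import Data.Empty using (⊥-elim)
open import Function using (_∘_)
open import Induction.WellFounded using (Acc; acc)
open import Relation.Nullary using (¬_; Dec; yes; no)
open import Relation.Nullary.Decidable using (decidable-stable; ¬¬-excluded-middle; _×-dec_; _⊎-dec_)
open import Relation.Nullary.Negation using (¬¬-map)
open import Relation.Binary.PropositionalEquality using (_≡_; _≢_; refl; sym; cong; subst)

data Direction : Set where
  rightward leftward : Direction

infix 4 _≺[_]_ _≼[_]_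

_≺[_]_ : ℕ → Direction → ℕ → Set
x ≺[ rightward ] y = x < y
x ≺[ leftward ] y = y < x

_≼[_]_ : ℕ → Direction → ℕ → Set
x ≼[ rightward ] y = x ≤ y
x ≼[ leftward ] y = y ≤ x

≺? : ∀ o x y → Dec (x ≺[ o ] y)
≺? rightward x y = suc x ≤? y
≺? leftward x y = suc y ≤? x

≼? : ∀ o x y → Dec (x ≼[ o ] y)
≼? rightward x y = x ≤? y
≼? leftward x y = y ≤? x

≺-trans : ∀ o {x y z} → x ≺[ o ] y → y ≺[ o ] z → x ≺[ o ] z
≺-trans rightward p q = <-trans p q
≺-trans leftward p q = <-trans q p

≺⇒≢ : ∀ o {x y} → x ≺[ o ] y → x ≢ y
≺⇒≢ rightward p = <⇒≢ p
≺⇒≢ leftward p = <⇒≢ p ∘ sym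

⋠⇒≻ : ∀ o {x y} → ¬ x ≼[ o ] y → y ≺[ o ] x
⋠⇒≻ rightward = ≰⇒>
⋠⇒≻ leftward = ≰⇒>

⊀⇒≽ : ∀ o {x y} → ¬ x ≺[ o ] y → y ≼[ o ] x
⊀⇒≽ rightward = ≮⇒≥
⊀⇒≽ leftward = ≮⇒≥

≼-≺-between : ∀ o {x y z} → x ≼[ o ] y → y ≺[ o ] z → x ⊓ z ≤ y × y ≤ x ⊔ z
≼-≺-between rightward {x} {y} {z} x≤y y<z = ≤-trans (m⊓n≤m x z) x≤y , ≤-trans (<⇒≤ y<z) (m≤n⊔m x z)
≼-≺-between leftward {x} {y} {z} y≤x z<y = ≤-trans (m⊓n≤n x z) (<⇒≤ z<y) , ≤-trans y≤x (m≤m⊔n x z)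

accessAt-toℕ : ∀ {n m} (X : Vec (Fin n) m) i → accessAt X (toℕ i) ≡ toℕ (lookup X i)
accessAt-toℕ (x ∷ X) Fin.zero = refl
accessAt-toℕ (x ∷ X) (Fin.suc i) = accessAt-toℕ X i

module GreedyProperties {n m : ℕ} (T : BST 0 n) (X : Vec (Fin n) m) where
  open Greedy T X

  InX⇒<n : ∀ {c t} → InX c t → c < n
  InX⇒<n (i , _ , refl) = toℕ<n (lookup X i)

  access∈X : ∀ {s} → s < m → InX (accessAt X s) (suc s)
  access∈X {s} s<m = i , cong suc (sym (toℕ-fromℕ< s<m)) , sym access≡
    where
    i = fromℕ< s<m
    access≡ : accessAt X s ≡ toℕ (lookup X i)
    access≡ = subst (λ s′ → accessAt X s′ ≡ toℕ (lookup X i)) (toℕ-fromℕ< s<m) (accessAt-toℕ X i)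

  any-InX? : (R : ℕ → ℕ → Set) → (∀ c t → Dec (R c t)) → Dec (Σ ℕ λ c → Σ ℕ λ t → InX c t × R c t)
  any-InX? R R? with any? (λ i → R? (toℕ (lookup X i)) (suc (toℕ i)))
  ... | yes (i , r) = yes (_ , _ , (i , refl , refl) , r)
  ... | no ¬r = no λ { (_ , _ , (i , refl , refl) , r) → ¬r (i , r) }

  Pts-row-bound : ∀ {k c r} → Pts k (c , r) → r ℤ.≤ + k
  Pts-row-bound {zero} {c} (_ , refl) with depth T c
  ... | zero = +≤+ z≤n
  ... | suc _ = -≤+
  Pts-row-bound {suc k} (inj₁ (r≤k , _)) = ℤ.≤-trans r≤k (+≤+ (n≤1+n k))
  Pts-row-bound {suc k} (inj₂ (refl , _)) = ℤ.≤-refl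

  Pts-mono : ∀ {j k c r} → j ≤ k → Pts j (c , r) → Pts k (c , r)
  Pts-mono = mono′ ∘ ≤⇒≤′
    where
    mono′ : ∀ {j k c r} → j ≤′ k → Pts j (c , r) → Pts k (c , r)
    mono′ ≤′-refl P = P
    mono′ (≤′-step j≤k) P = inj₁ (Pts-row-bound (mono′ j≤k P) , mono′ j≤k P)

  Pts-restrict : ∀ {j k c r} → j ≤ k → Pts k (c , r) → r ℤ.≤ + j → Pts j (c , r)
  Pts-restrict = restrict′ ∘ ≤⇒≤′
    where
    restrict′ : ∀ {j k c r} → j ≤′ k → Pts k (c , r) → r ℤ.≤ + j → Pts j (c , r)
    restrict′ ≤′-refl P _ = P
    restrict′ (≤′-step j≤k) (inj₁ (_ , P)) r≤j = restrict′ j≤k P r≤j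
    restrict′ (≤′-step j≤k) (inj₂ (refl , _)) (+≤+ k<j) = ⊥-elim (<⇒≱ (s≤s (≤′⇒≤ j≤k)) k<j)

  Pts⇒Added : ∀ {s k c} → s < k → Pts k (c , + suc s) → Added s c
  Pts⇒Added s<k P with Pts-restrict s<k P ℤ.≤-refl
  ... | inj₁ (+≤+ s<s , _) = ⊥-elim (<-irrefl refl s<s)
  ... | inj₂ (_ , A) = A

  IsLastRow : ℕ → ℕ → ℤ → Set
  IsLastRow k c τ = Pts k (c , τ) × (∀ r → Pts k (c , r) → r ℤ.≤ τ)

  -- Membership in the picture is not known to be decidable, so the last row exists only up to ¬¬.
  ¬¬lastRow : ∀ k {c} → c < n → ¬ ¬ (Σ ℤ (IsLastRow k c))
  ¬¬lastRow zero c<n k = k (_ , (c<n , refl) , λ { r (_ , r≡) → ≤-reflexive r≡ })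
  ¬¬lastRow (suc j) c<n k = ¬¬-excluded-middle λ
    { (yes A) → k (+ suc j , inj₂ (refl , A) , λ r → Pts-row-bound)
    ; (no ¬A) → ¬¬lastRow j c<n λ { (τ , P , last) →
        k (τ , inj₁ (Pts-row-bound P , P) , λ
          { r (inj₁ (_ , P′)) → last r P′
          ; r (inj₂ (_ , A)) → ⊥-elim (¬A A) }) } }

  ¬¬Added-access : ∀ {s} → s < m → ¬ ¬ Added s (accessAt X s)
  ¬¬Added-access {s} s<m = ¬¬-map added (¬¬lastRow s x<n)
    where
    x = accessAt X s
    x<n = InX⇒<n (access∈X s<m)
    added : Σ ℤ (IsLastRow s x) → Added s x
    added (τ , P , last) = x<n , τ , (P , last) , degenerate
      where
      degenerate : ∀ c r → x ⊓ x ≤ c → c ≤ x ⊔ x → τ ℤ.≤ r → r ℤ.≤ + suc s →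
        Pts s (c , r) ⊎ (c , r) ≡ (x , + suc s) → (c , r) ≡ (x , + suc s) ⊎ (c , r) ≡ (x , τ)
      degenerate c r x⊓x≤c c≤x⊔x τ≤r _ (inj₂ p≡) = inj₁ p≡
      degenerate c r x⊓x≤c c≤x⊔x τ≤r _ (inj₁ Q)
        with ≤-antisym (subst (_≤ c) (⊓-idem x) x⊓x≤c) (subst (c ≤_) (⊔-idem x) c≤x⊔x)
      ... | refl = inj₂ (cong (x ,_) (ℤ.≤-antisym (last r Q) τ≤r))

  -- The rectangle of (x_{s+1}, s+1) and the previous point (c, τ) of column c was empty, so
  -- every point of the picture in its column span, other than (c, τ), lies below row τ.
  previousAdded : ∀ {s c d r} → Added s c →
    accessAt X s ⊓ c ≤ d → d ≤ accessAt X s ⊔ c → d ≢ c → Pts s (d , + r) →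
    Σ ℕ λ u → r ≤ u × u < s × Added u c
  previousAdded {s} {c} {d} {r} (_ , τ , (Pτ , _) , empty) x⊓c≤d d≤x⊔c d≢c Pd = above τ Pτ τ≰r
    where
    τ≰r : ¬ τ ℤ.≤ + r
    τ≰r τ≤r with empty d (+ r) x⊓c≤d d≤x⊔c τ≤r (ℤ.≤-trans (Pts-row-bound Pd) (+≤+ (n≤1+n s))) (inj₁ Pd)
    ... | inj₁ d≡x = <-irrefl (+-injective (cong proj₂ d≡x)) (s≤s (ℤ.drop‿+≤+ (Pts-row-bound Pd)))
    ... | inj₂ d≡c = d≢c (cong proj₁ d≡c)
    above : ∀ τ → Pts s (c , τ) → ¬ τ ℤ.≤ + r → Σ ℕ λ u → r ≤ u × u < s × Added u c
    above -[1+ _ ] _ τ≰r = ⊥-elim (τ≰r -≤+)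
    above (+ zero) _ τ≰r = ⊥-elim (τ≰r (+≤+ z≤n))
    above (+ suc u) P τ≰r with Pts-row-bound P
    ... | +≤+ u<s = u , s≤s⁻¹ (≰⇒> (τ≰r ∘ +≤+)) , u<s , Pts⇒Added u<s P

  EscapeAccess : Direction → (c₀ t₂ d t₁ : ℕ) → Set
  EscapeAccess o c₀ t₂ d t₁ = Σ ℕ λ c → Σ ℕ λ t → InX c t ×
    ((c₀ ≼[ o ] c × suc t₁ ≤ t × t ≤ t₂) ⊎ (d ≺[ o ] c × t ≡ t₂))

  module Staircase (o : Direction) {c₀ s₂ : ℕ} (t₂≤m : suc s₂ ≤ m) (A₀ : Added s₂ c₀) where

    Escape : ℕ → ℕ → Set
    Escape = EscapeAccess o c₀ (suc s₂)

    EscapeAbove : ℕ → Set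
    EscapeAbove t₁ = ∀ {d t₁′} → d ≺[ o ] c₀ → t₁ < t₁′ → t₁′ ≤ s₂ → Pts m (d , + t₁′) → Escape d t₁′

    escape? : ∀ d t₁ → Dec (Escape d t₁)
    escape? d t₁ = any-InX? _ λ c t →
      (≼? o c₀ c ×-dec suc t₁ ≤? t ×-dec t ≤? suc s₂) ⊎-dec (≺? o d c ×-dec t ≟ suc s₂)

    escape-weaken : ∀ {d t₁ d′ t₁′} → d ≺[ o ] d′ → t₁ < t₁′ → Escape d′ t₁′ → Escape d t₁
    escape-weaken _ t₁<t₁′ (c , t , c∈X , inj₁ (c₀≼c , t₁′<t , t≤t₂)) =
      c , t , c∈X , inj₁ (c₀≼c , <-trans t₁<t₁′ t₁′<t , t≤t₂)
    escape-weaken d≺d′ _ (c , t , c∈X , inj₂ (d′≺c , t≡t₂)) =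
      c , t , c∈X , inj₂ (≺-trans o d≺d′ d′≺c , t≡t₂)

    descend : ∀ {d t₁} → EscapeAbove t₁ → d ≺[ o ] c₀ → Pts m (d , + t₁) →
      ∀ {s} → Acc _<_ s → t₁ ≤ s → s ≤ s₂ → Added s c₀ → Escape d t₁
    descend {d} {t₁} restart d≺c₀ Pd {s} (acc smaller) t₁≤s s≤s₂ A
      with ≼? o c₀ (accessAt X s)
    ... | yes c₀≼x = _ , _ , access∈X s<m , inj₁ (c₀≼x , s≤s t₁≤s , s≤s s≤s₂)
      where s<m = ≤-trans (s≤s s≤s₂) t₂≤m
    ... | no c₀⋠x with ≺? o d (accessAt X s)
    ...   | no d⊀x = descend restart d≺c₀ Pd (smaller u<s) t₁≤u (≤-trans (<⇒≤ u<s) s≤s₂) Au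
      where
      s<m = ≤-trans (s≤s s≤s₂) t₂≤m
      between = ≼-≺-between o (⊀⇒≽ o d⊀x) d≺c₀
      previous = previousAdded A (proj₁ between) (proj₂ between) (≺⇒≢ o d≺c₀)
                   (Pts-restrict (<⇒≤ s<m) Pd (+≤+ t₁≤s))
      u = proj₁ previous
      t₁≤u = proj₁ (proj₂ previous)
      u<s = proj₁ (proj₂ (proj₂ previous))
      Au = proj₂ (proj₂ (proj₂ previous))
    ...   | yes d≺x with s ≟ s₂
    ...     | yes refl = _ , _ , access∈X t₂≤m , inj₂ (d≺x , refl)
    -- The goal is decidable, so the ¬¬-available access point (x_{s+1}, s+1) may be used.
    ...     | no s≢s₂ = decidable-stable (escape? d t₁) (¬¬-map from-access (¬¬Added-access s<m))
      where
      s<m = ≤-trans (s≤s s≤s₂) t₂≤m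
      from-access : Added s (accessAt X s) → Escape d t₁
      from-access Ax = escape-weaken d≺x (s≤s t₁≤s)
        (restart (⋠⇒≻ o c₀⋠x) (s≤s t₁≤s) (≤∧≢⇒< s≤s₂ s≢s₂) (Pts-mono s<m (inj₂ (refl , Ax))))

    staircase : ∀ {d t₁} → Acc _<_ (s₂ ∸ t₁) → d ≺[ o ] c₀ → t₁ ≤ s₂ → Pts m (d , + t₁) → Escape d t₁
    staircase {t₁ = t₁} (acc smaller) d≺c₀ t₁≤s₂ Pd =
      descend restart d≺c₀ Pd (<-wellFounded s₂) t₁≤s₂ ≤-refl A₀
      where
      restart : EscapeAbove t₁
      restart d′≺c₀ t₁<t₁′ t₁′≤s₂ = staircase (smaller (∸-monoʳ-< t₁<t₁′ t₁′≤s₂)) d′≺c₀ t₁′≤s₂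

  escapeAccess : ∀ o {c₀ d t₁ t₂} → d ≺[ o ] c₀ → t₁ < t₂ → InG c₀ t₂ → InG d t₁ →
    EscapeAccess o c₀ t₂ d t₁
  escapeAccess o {t₂ = suc s₂} d≺c₀ (s≤s t₁≤s₂) (_ , t₂≤m , Pc₀) (_ , _ , Pd) =
    staircase (<-wellFounded _) d≺c₀ t₁≤s₂ Pd
    where open Staircase o t₂≤m (Pts⇒Added t₂≤m Pc₀)

open GreedyProperties using (escapeAccess)

mainTheorem13 : {n m : ℕ} (T : BST 0 n) (X : Vec (Fin n) m) (a b t₁ t₂ : ℕ) →
    a < b → t₁ < t₂ →
    ((Greedy.InG T X b t₂ × ¬ Greedy.InX T X b t₂ × Greedy.InG T X a t₁) →
      Σ ℕ λ c → Σ ℕ λ t → Greedy.InX T X c t ×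
        ((b ≤ c × suc t₁ ≤ t × t ≤ t₂) ⊎ (suc a ≤ c × t ≡ t₂))) ×
    ((Greedy.InG T X a t₂ × ¬ Greedy.InX T X a t₂ × Greedy.InG T X b t₁) →
      Σ ℕ λ c → Σ ℕ λ t → Greedy.InX T X c t ×
        ((c ≤ a × suc t₁ ≤ t × t ≤ t₂) ⊎ (suc c ≤ b × t ≡ t₂)))
mainTheorem13 T X a b t₁ t₂ a<b t₁<t₂ =
    (λ (b∈G , _ , a∈G) → escapeAccess T X rightward a<b t₁<t₂ b∈G a∈G)
  , (λ (a∈G , _ , b∈G) → escapeAccess T X leftward a<b t₁<t₂ a∈G b∈G)
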